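{- Let $G$ be a graph. If $G$ has an odd number of edges, then $\eta(G)=0$. Otherwise $\eta(G)=\sum_{v\in V(G)}\eta(G-v)$.
   Context: An ordering $(\pi_1,\dots,\pi_n)$ of $V(G)$ is an even sequence if for every $1\le i\le n$ the induced subgraph $G[\{\pi_1,\dots,\pi_i\}]$ has an even number of edges; $\eta(G)$ is the number of even sequences of $G$. -}

module Defs where

open import Data.Bool using (Bool; true; false; _∧_; not; if_then_else_)
open import Data.Nat using (ℕ; zero; suc; _+_; _%_)
open import Data.Fin using (Fin; punchIn; _≟_)
open import Data.List using (List; []; _∷_; length; map; filter; take; allFin; upTo; concatMap)
open import Data.Bool.ListAction using (all; any)
open import Data.Vec using (Vec; toList)
import Data.Vec as V
open import Relation.Binary.PropositionalEquality using (_≡_)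
open import Relation.Nullary.Decidable using (⌊_⌋)
open import Data.Bool.Properties using (T?)

record Graph (n : ℕ) : Set where
  field
    adj   : Fin n → Fin n → Bool
    sym   : ∀ i j → adj i j ≡ adj j i
    irrefl : ∀ i → adj i i ≡ false
open Graph public

_-v_ : ∀ {m} → Graph (suc m) → Fin (suc m) → Graph m
G -v v = record
  { adj    = λ i j → adj G (punchIn v i) (punchIn v j)
  ; sym    = λ i j → sym G (punchIn v i) (punchIn v j)
  ; irrefl = λ i → irrefl G (punchIn v i) }

-- number of edges of the subgraph induced by a list of distinct vertices
-- (each unordered pair counted once: x paired with the later entries)
inducedEdges : ∀ {n} → Graph n → List (Fin n) → ℕ
inducedEdges G []       = 0
inducedEdges G (x ∷ xs) = length (filter (λ y → T? (adj G x y)) xs) + inducedEdges G xs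

numEdges : ∀ {n} → Graph n → ℕ
numEdges G = inducedEdges G (allFin _)

isEven : ℕ → Bool
isEven k = ⌊ k % 2 Data.Nat.≟ 0 ⌋

allVecs : (n k : ℕ) → List (Vec (Fin n) k)
allVecs n zero    = V.[] ∷ []
allVecs n (suc k) = concatMap (λ x → map (x V.∷_) (allVecs n k)) (allFin n)

distinct : ∀ {n} → List (Fin n) → Bool
distinct []       = true
distinct (x ∷ xs) = not (any (λ y → ⌊ x ≟ y ⌋) xs) ∧ distinct xs

-- every prefix π₁..πᵢ (1 ≤ i ≤ n) induces an even number of edges
evenPrefixes : ∀ {n} → Graph n → List (Fin n) → Bool
evenPrefixes {n} G xs = all (λ i → isEven (inducedEdges G (take (suc i) xs))) (upTo n)

-- an ordering (π₁,…,πₙ) of V(G) is a length-n list of distinct vertices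
isEvenSequence : ∀ {n} → Graph n → Vec (Fin n) n → Bool
isEvenSequence G π = distinct (toList π) ∧ evenPrefixes G (toList π)

η : ∀ {n} → Graph n → ℕ
η {n} G = length (filter (λ π → T? (isEvenSequence G π)) (allVecs n n))

-- Sort the orderings of V(G) by their last vertex v.  An ordering ending in v that repeats
-- no vertex is a relabelled ordering of G - v followed by v: its prefixes of length < n are
-- those of the ordering of G - v, while its full prefix induces every edge of G.  Hence no
-- ordering is even when |E(G)| is odd, and when |E(G)| is even the even sequences ending in v
-- correspond exactly to the even sequences of G - v.
module Submission where

open import Defs hiding (sym)
open import Data.Bool using (Bool; true; false; _∧_; _∨_; not)
open import Data.Bool.ListAction using (and; all; any)
open import Data.Bool.Properties using (T?; ∧-assoc; ∧-identityʳ; ∧-zeroʳ; ∨-zeroʳ)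
open import Data.Fin using (Fin; zero; suc; punchIn; punchOut; _≟_)
open import Data.Fin.Properties using (punchIn-injective; punchInᵢ≢i; punchIn-punchOut)
open import Data.List using (List; []; _∷_; _++_; _∷ʳ_; length; map; filter; take; tabulate; allFin; upTo; concatMap)
open import Data.List.Membership.Propositional using () renaming (_∈_ to _∈ₗ_)
open import Data.List.Properties using (map-cong; map-cong-local; map-∘; map-++; length-map; length-++; take-map; take-all; upTo-∷ʳ)
import Data.List.Relation.Unary.All as All
open import Data.List.Relation.Unary.All.Properties using (all-upTo)
open import Data.List.Relation.Unary.Any using (here; there)
open import Data.Nat using (ℕ; zero; suc; _+_; _*_; _≤_; _<_; s≤s)
open import Data.Nat.ListAction using (sum)
open import Data.Nat.ListAction.Properties using (sum-++)
open import Data.Nat.Properties using (+-0-commutativeMonoid; +-commutativeSemigroup; +-comm; suc-injective; *-cancelˡ-≡; ≤-reflexive; ≤-trans)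
open import Data.Nat.Solver using (module +-*-Solver)
open import Data.Product using (_×_; _,_; ∃)
open import Data.Vec using (Vec; toList)
import Data.Vec as V
open import Data.Vec.Membership.Propositional using (_∈_)
open import Data.Vec.Membership.Propositional.Properties using (∈-toList⁺)
open import Data.Vec.Properties using (toList-∷ʳ; toList-map; length-toList)
open import Data.Vec.Relation.Unary.Any using (here; there)
open import Function using (_∘_; id)
open import Function.Definitions using (Injective)
open import Relation.Binary.PropositionalEquality using (_≡_; _≢_; refl; sym; trans; cong; cong₂; module ≡-Reasoning)
open import Relation.Nullary using (yes; no)
open import Relation.Nullary.Decidable using (⌊_⌋; isYes≗does; dec-true; dec-false)

open import Algebra.Properties.CommutativeMonoid.Sum +-0-commutativeMonoid
  using (sum-syntax; sum-remove; sum-cong-≗; sum-replicate-zero; ∑-comm)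
open import Algebra.Properties.CommutativeSemigroup +-commutativeSemigroup using (interchange)
open ≡-Reasoning

private
  variable
    A B : Set

listSum : List A → (A → ℕ) → ℕ
listSum xs f = sum (map f xs)

infixl 10 listSum
syntax listSum xs (λ x → e) = ∑[ x ∈ xs ] e

𝟙 : Bool → ℕ
𝟙 true  = 1
𝟙 false = 0

length-filter-T? : ∀ (p : A → Bool) xs → length (filter (T? ∘ p) xs) ≡ ∑[ x ∈ xs ] 𝟙 (p x)
length-filter-T? p []       = refl
length-filter-T? p (x ∷ xs) with p x
... | true  = cong suc (length-filter-T? p xs)
... | false = length-filter-T? p xs

∑-cong : ∀ {f g : A → ℕ} → (∀ x → f x ≡ g x) → ∀ xs → ∑[ x ∈ xs ] f x ≡ ∑[ x ∈ xs ] g x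
∑-cong f≗g xs = cong sum (map-cong f≗g xs)

∑-zero : ∀ {f : A → ℕ} → (∀ x → f x ≡ 0) → ∀ xs → ∑[ x ∈ xs ] f x ≡ 0
∑-zero f≗0 []       = refl
∑-zero f≗0 (x ∷ xs) = cong₂ _+_ (f≗0 x) (∑-zero f≗0 xs)

∑-distrib-+ : ∀ (f g : A → ℕ) xs → ∑[ x ∈ xs ] (f x + g x) ≡ ∑[ x ∈ xs ] f x + ∑[ x ∈ xs ] g x
∑-distrib-+ f g []       = refl
∑-distrib-+ f g (x ∷ xs) = trans (cong (f x + g x +_) (∑-distrib-+ f g xs)) (interchange (f x) (g x) _ _)

∑-++ : ∀ (f : A → ℕ) xs ys → ∑[ x ∈ xs ++ ys ] f x ≡ ∑[ x ∈ xs ] f x + ∑[ x ∈ ys ] f x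
∑-++ f xs ys = trans (cong sum (map-++ f xs ys)) (sum-++ (map f xs) (map f ys))

∑-map : ∀ (h : A → B) (f : B → ℕ) xs → ∑[ y ∈ map h xs ] f y ≡ ∑[ x ∈ xs ] f (h x)
∑-map h f xs = cong sum (sym (map-∘ {g = f} {f = h} xs))

∑-concatMap : ∀ (h : A → List B) (f : B → ℕ) xs →
              ∑[ y ∈ concatMap h xs ] f y ≡ ∑[ x ∈ xs ] ∑[ y ∈ h x ] f y
∑-concatMap h f []       = refl
∑-concatMap h f (x ∷ xs) = trans (∑-++ f (h x) (concatMap h xs)) (cong (_ +_) (∑-concatMap h f xs))

∑-tabulate : ∀ n (h : Fin n → A) (f : A → ℕ) → ∑[ x ∈ tabulate h ] f x ≡ ∑[ i < n ] f (h i)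
∑-tabulate zero    h f = refl
∑-tabulate (suc n) h f = cong (f (h zero) +_) (∑-tabulate n (h ∘ suc) f)

∑-allVecs-∷ : ∀ n k (f : Vec (Fin n) (suc k) → ℕ) →
              ∑[ w ∈ allVecs n (suc k) ] f w ≡ ∑[ x < n ] ∑[ w ∈ allVecs n k ] f (x V.∷ w)
∑-allVecs-∷ n k f = begin
  ∑[ w ∈ allVecs n (suc k) ] f w
    ≡⟨ ∑-concatMap (λ x → map (x V.∷_) (allVecs n k)) f (allFin n) ⟩
  ∑[ x ∈ allFin n ] ∑[ w ∈ map (x V.∷_) (allVecs n k) ] f w
    ≡⟨ ∑-cong (λ x → ∑-map (x V.∷_) f (allVecs n k)) (allFin n) ⟩
  ∑[ x ∈ allFin n ] ∑[ w ∈ allVecs n k ] f (x V.∷ w)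
    ≡⟨ ∑-tabulate n id _ ⟩
  ∑[ x < n ] ∑[ w ∈ allVecs n k ] f (x V.∷ w) ∎

∑-allVecs-∷ʳ : ∀ n k (f : Vec (Fin n) (suc k) → ℕ) →
               ∑[ w ∈ allVecs n (suc k) ] f w ≡ ∑[ v < n ] ∑[ w ∈ allVecs n k ] f (w V.∷ʳ v)
∑-allVecs-∷ʳ n zero    f = ∑-allVecs-∷ n zero f
∑-allVecs-∷ʳ n (suc k) f = begin
  ∑[ w ∈ allVecs n (suc (suc k)) ] f w
    ≡⟨ ∑-allVecs-∷ n (suc k) f ⟩
  ∑[ x < n ] ∑[ w ∈ allVecs n (suc k) ] f (x V.∷ w)
    ≡⟨ sum-cong-≗ (λ x → ∑-allVecs-∷ʳ n k (λ w → f (x V.∷ w))) ⟩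
  ∑[ x < n ] ∑[ v < n ] ∑[ w ∈ allVecs n k ] f ((x V.∷ w) V.∷ʳ v)
    ≡⟨ ∑-comm (λ x v → ∑[ w ∈ allVecs n k ] f ((x V.∷ w) V.∷ʳ v)) ⟩
  ∑[ v < n ] ∑[ x < n ] ∑[ w ∈ allVecs n k ] f ((x V.∷ w) V.∷ʳ v)
    ≡⟨ sum-cong-≗ (λ v → sym (∑-allVecs-∷ n k (λ w → f (w V.∷ʳ v)))) ⟩
  ∑[ v < n ] ∑[ w ∈ allVecs n (suc k) ] f (w V.∷ʳ v) ∎

∑-allVecs-punchIn : ∀ m k (v : Fin (suc m)) (f : Vec (Fin (suc m)) k → ℕ) → (∀ w → v ∈ w → f w ≡ 0) →
                    ∑[ w ∈ allVecs (suc m) k ] f w ≡ ∑[ w ∈ allVecs m k ] f (V.map (punchIn v) w)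
∑-allVecs-punchIn m zero    v f f-vanishes = refl
∑-allVecs-punchIn m (suc k) v f f-vanishes = begin
  ∑[ w ∈ allVecs (suc m) (suc k) ] f w
    ≡⟨ ∑-allVecs-∷ (suc m) k f ⟩
  ∑[ x < suc m ] ∑[ w ∈ allVecs (suc m) k ] f (x V.∷ w)
    ≡⟨ sum-remove {i = v} (λ x → ∑[ w ∈ allVecs (suc m) k ] f (x V.∷ w)) ⟩
  ∑[ w ∈ allVecs (suc m) k ] f (v V.∷ w) + ∑[ y < m ] ∑[ w ∈ allVecs (suc m) k ] f (punchIn v y V.∷ w)
    ≡⟨ cong₂ _+_ (∑-zero (λ w → f-vanishes (v V.∷ w) (here refl)) (allVecs (suc m) k))
                 (sum-cong-≗ (λ y → ∑-allVecs-punchIn m k v (λ w → f (punchIn v y V.∷ w))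
                                                        (λ w v∈w → f-vanishes (punchIn v y V.∷ w) (there v∈w)))) ⟩
  ∑[ y < m ] ∑[ w ∈ allVecs m k ] f (punchIn v y V.∷ V.map (punchIn v) w)
    ≡⟨ sym (∑-allVecs-∷ m k (f ∘ V.map (punchIn v))) ⟩
  ∑[ w ∈ allVecs m (suc k) ] f (V.map (punchIn v) w) ∎

≟-injective : ∀ {m n} {f : Fin m → Fin n} → Injective _≡_ _≡_ f → ∀ x y → ⌊ f x ≟ f y ⌋ ≡ ⌊ x ≟ y ⌋
≟-injective {f = f} f-inj x y with x ≟ y
... | yes refl = trans (isYes≗does (f x ≟ f x)) (dec-true (f x ≟ f x) refl)
... | no  x≢y  = trans (isYes≗does (f x ≟ f y)) (dec-false (f x ≟ f y) (x≢y ∘ f-inj))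

any-≟-map : ∀ {m n} {f : Fin m → Fin n} → Injective _≡_ _≡_ f → ∀ x ys →
            any (λ y → ⌊ f x ≟ y ⌋) (map f ys) ≡ any (λ y → ⌊ x ≟ y ⌋) ys
any-≟-map f-inj x []       = refl
any-≟-map f-inj x (y ∷ ys) = cong₂ _∨_ (≟-injective f-inj x y) (any-≟-map f-inj x ys)

any-≟-map-∷ʳ : ∀ {m n} {f : Fin m → Fin n} {v} → Injective _≡_ _≡_ f → (∀ x → f x ≢ v) → ∀ x ys →
               any (λ y → ⌊ f x ≟ y ⌋) (map f ys ∷ʳ v) ≡ any (λ y → ⌊ x ≟ y ⌋) ys
any-≟-map-∷ʳ {f = f} {v} f-inj v∉f x []       =
  cong (_∨ false) (trans (isYes≗does (f x ≟ v)) (dec-false (f x ≟ v) (v∉f x)))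
any-≟-map-∷ʳ             f-inj v∉f x (y ∷ ys) = cong₂ _∨_ (≟-injective f-inj x y) (any-≟-map-∷ʳ f-inj v∉f x ys)

distinct-map : ∀ {m n} {f : Fin m → Fin n} → Injective _≡_ _≡_ f → ∀ xs → distinct (map f xs) ≡ distinct xs
distinct-map f-inj []       = refl
distinct-map f-inj (x ∷ xs) = cong₂ (λ a d → not a ∧ d) (any-≟-map f-inj x xs) (distinct-map f-inj xs)

distinct-map-∷ʳ : ∀ {m n} {f : Fin m → Fin n} {v} → Injective _≡_ _≡_ f → (∀ x → f x ≢ v) → ∀ xs →
                  distinct (map f xs ∷ʳ v) ≡ distinct xs
distinct-map-∷ʳ f-inj v∉f []       = refl
distinct-map-∷ʳ f-inj v∉f (x ∷ xs) =
  cong₂ (λ a d → not a ∧ d) (any-≟-map-∷ʳ f-inj v∉f x xs) (distinct-map-∷ʳ f-inj v∉f xs)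

any-∷ʳ : ∀ (p : A → Bool) {v} → p v ≡ true → ∀ xs → any p (xs ∷ʳ v) ≡ true
any-∷ʳ p pv []       = cong (_∨ false) pv
any-∷ʳ p pv (x ∷ xs) = trans (cong (p x ∨_) (any-∷ʳ p pv xs)) (∨-zeroʳ (p x))

distinct-∷ʳ-∈ : ∀ {n} {v : Fin n} {xs} → v ∈ₗ xs → distinct (xs ∷ʳ v) ≡ false
distinct-∷ʳ-∈ {v = v} (here {xs = xs} refl)
  rewrite any-∷ʳ (λ y → ⌊ v ≟ y ⌋) (trans (isYes≗does (v ≟ v)) (dec-true (v ≟ v) refl)) xs = refl
distinct-∷ʳ-∈ (there v∈xs) rewrite distinct-∷ʳ-∈ v∈xs = ∧-zeroʳ _

map-punchIn-surjective : ∀ {m} (v : Fin (suc m)) xs → any (λ y → ⌊ v ≟ y ⌋) xs ≡ false →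
                         ∃ λ ys → map (punchIn v) ys ≡ xs
map-punchIn-surjective v []       v∉xs = [] , refl
map-punchIn-surjective v (x ∷ xs) v∉xs with v ≟ x
... | no v≢x with map-punchIn-surjective v xs v∉xs
...   | ys , refl = punchOut v≢x ∷ ys , cong (_∷ _) (punchIn-punchOut v≢x)

IsOrdering : ∀ n → List (Fin n) → Set
IsOrdering n xs = distinct xs ≡ true × length xs ≡ n

∑-ordering : ∀ n xs → IsOrdering n xs → ∀ (g : Fin n → ℕ) → ∑[ x ∈ xs ] g x ≡ ∑[ i < n ] g i
∑-ordering zero    []     _ g = refl
∑-ordering (suc m) (v ∷ xs) _ g with any (λ y → ⌊ v ≟ y ⌋) xs in v∉xs | distinct xs in d
∑-ordering (suc m) (v ∷ xs) (() , _) g | true  | _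
∑-ordering (suc m) (v ∷ xs) (() , _) g | false | false
∑-ordering (suc m) (v ∷ xs) (_ , l)  g | false | true with map-punchIn-surjective v xs v∉xs
... | ys , refl = begin
  g v + ∑[ x ∈ map (punchIn v) ys ] g x ≡⟨ cong (g v +_) (∑-map (punchIn v) g ys) ⟩
  g v + ∑[ y ∈ ys ] g (punchIn v y)     ≡⟨ cong (g v +_) (∑-ordering m ys ys-ordering (g ∘ punchIn v)) ⟩
  g v + ∑[ i < m ] g (punchIn v i)      ≡⟨ sum-remove {i = v} g ⟨
  ∑[ i < suc m ] g i                    ∎
  where
  ys-ordering : IsOrdering m ys
  ys-ordering = trans (sym (distinct-map (punchIn-injective v _ _) ys)) d
              , trans (sym (length-map (punchIn v) ys)) (suc-injective l)

inducedEdges-map-punchIn : ∀ {m} (G : Graph (suc m)) v xs →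
                           inducedEdges G (map (punchIn v) xs) ≡ inducedEdges (G -v v) xs
inducedEdges-map-punchIn G v []       = refl
inducedEdges-map-punchIn G v (x ∷ xs) = cong₂ _+_ degree (inducedEdges-map-punchIn G v xs)
  where
  degree : length (filter (T? ∘ adj G (punchIn v x)) (map (punchIn v) xs))
         ≡ length (filter (T? ∘ adj (G -v v) x) xs)
  degree = begin
    length (filter (T? ∘ adj G (punchIn v x)) (map (punchIn v) xs))
      ≡⟨ length-filter-T? (adj G (punchIn v x)) (map (punchIn v) xs) ⟩
    ∑[ y ∈ map (punchIn v) xs ] 𝟙 (adj G (punchIn v x) y)
      ≡⟨ ∑-map (punchIn v) (𝟙 ∘ adj G (punchIn v x)) xs ⟩
    ∑[ y ∈ xs ] 𝟙 (adj (G -v v) x y)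
      ≡⟨ length-filter-T? (adj (G -v v) x) xs ⟨
    length (filter (T? ∘ adj (G -v v) x) xs) ∎

double-inducedEdges : ∀ {n} (G : Graph n) xs → 2 * inducedEdges G xs ≡ ∑[ a ∈ xs ] ∑[ c ∈ xs ] 𝟙 (adj G a c)
double-inducedEdges G []       = refl
double-inducedEdges G (x ∷ xs) = begin
  2 * (length (filter (T? ∘ adj G x) xs) + inducedEdges G xs)
    ≡⟨ cong (λ d → 2 * (d + inducedEdges G xs)) (length-filter-T? (adj G x) xs) ⟩
  2 * (d + inducedEdges G xs)
    ≡⟨ double-+ d (inducedEdges G xs) ⟩
  d + (d + 2 * inducedEdges G xs)
    ≡⟨ cong₂ (λ d′ r → d + (d′ + r)) (∑-cong (λ a → cong 𝟙 (Graph.sym G x a)) xs) (double-inducedEdges G xs) ⟩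
  d + (∑[ a ∈ xs ] 𝟙 (adj G a x) + ∑[ a ∈ xs ] ∑[ c ∈ xs ] 𝟙 (adj G a c))
    ≡⟨ cong (d +_) (∑-distrib-+ (λ a → 𝟙 (adj G a x)) (λ a → ∑[ c ∈ xs ] 𝟙 (adj G a c)) xs) ⟨
  d + rows
    ≡⟨ cong (λ b → 𝟙 b + d + rows) (irrefl G x) ⟨
  𝟙 (adj G x x) + d + rows ∎
  where
  d rows : ℕ
  d    = ∑[ c ∈ xs ] 𝟙 (adj G x c)
  rows = ∑[ a ∈ xs ] (𝟙 (adj G a x) + ∑[ c ∈ xs ] 𝟙 (adj G a c))
  open +-*-Solver
  double-+ : ∀ a b → 2 * (a + b) ≡ a + (a + 2 * b)
  double-+ = solve 2 (λ a b → con 2 :* (a :+ b) := a :+ (a :+ con 2 :* b)) refl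

inducedEdges-ordering : ∀ {n} (G : Graph n) xs → IsOrdering n xs → inducedEdges G xs ≡ numEdges G
inducedEdges-ordering {n} G xs xs-ordering = *-cancelˡ-≡ _ _ 2 (begin
  2 * inducedEdges G xs
    ≡⟨ double-inducedEdges G xs ⟩
  ∑[ a ∈ xs ] ∑[ c ∈ xs ] 𝟙 (adj G a c)
    ≡⟨ ∑-cong (λ a → ∑-ordering n xs xs-ordering (𝟙 ∘ adj G a)) xs ⟩
  ∑[ a ∈ xs ] ∑[ c < n ] 𝟙 (adj G a c)
    ≡⟨ ∑-ordering n xs xs-ordering (λ a → ∑[ c < n ] 𝟙 (adj G a c)) ⟩
  ∑[ a < n ] ∑[ c < n ] 𝟙 (adj G a c)
    ≡⟨ sum-cong-≗ (λ a → ∑-tabulate n id (𝟙 ∘ adj G a)) ⟨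
  ∑[ a < n ] ∑[ c ∈ allFin n ] 𝟙 (adj G a c)
    ≡⟨ ∑-tabulate n id (λ a → ∑[ c ∈ allFin n ] 𝟙 (adj G a c)) ⟨
  ∑[ a ∈ allFin n ] ∑[ c ∈ allFin n ] 𝟙 (adj G a c)
    ≡⟨ double-inducedEdges G (allFin n) ⟨
  2 * numEdges G ∎)

take-++ˡ : ∀ n (xs ys : List A) → n ≤ length xs → take n (xs ++ ys) ≡ take n xs
take-++ˡ zero    xs       ys _       = refl
take-++ˡ (suc n) (x ∷ xs) ys (s≤s n≤) = cong (x ∷_) (take-++ˡ n xs ys n≤)

length-∷ʳ : ∀ (xs : List A) x → length (xs ∷ʳ x) ≡ suc (length xs)
length-∷ʳ xs x = trans (length-++ xs) (+-comm _ 1)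

all-∷ʳ : ∀ (p : A → Bool) xs x → all p (xs ∷ʳ x) ≡ all p xs ∧ p x
all-∷ʳ p []       x = ∧-identityʳ (p x)
all-∷ʳ p (y ∷ xs) x = trans (cong (p y ∧_) (all-∷ʳ p xs x)) (sym (∧-assoc (p y) _ _))

evenPrefixesUpTo : ∀ {n} → Graph n → ℕ → List (Fin n) → Bool
evenPrefixesUpTo G k xs = all (λ i → isEven (inducedEdges G (take (suc i) xs))) (upTo k)

evenPrefixes-∷ʳ : ∀ {m} (G : Graph (suc m)) xs v → length xs ≡ m →
                  evenPrefixes G (xs ∷ʳ v) ≡ evenPrefixesUpTo G m xs ∧ isEven (inducedEdges G (xs ∷ʳ v))
evenPrefixes-∷ʳ {m} G xs v l = begin
  all even-prefix (upTo (suc m))       ≡⟨ cong (all even-prefix) (upTo-∷ʳ m) ⟨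
  all even-prefix (upTo m ∷ʳ m)        ≡⟨ all-∷ʳ even-prefix (upTo m) m ⟩
  all even-prefix (upTo m) ∧ even-prefix m
    ≡⟨ cong₂ _∧_ (cong and (map-cong-local (All.map proper-prefix (all-upTo m)))) whole ⟩
  evenPrefixesUpTo G m xs ∧ isEven (inducedEdges G (xs ∷ʳ v)) ∎
  where
  even-prefix : ℕ → Bool
  even-prefix i = isEven (inducedEdges G (take (suc i) (xs ∷ʳ v)))
  proper-prefix : ∀ {i} → i < m → even-prefix i ≡ isEven (inducedEdges G (take (suc i) xs))
  proper-prefix {i} i<m =
    cong (isEven ∘ inducedEdges G) (take-++ˡ (suc i) xs (v ∷ []) (≤-trans i<m (≤-reflexive (sym l))))
  whole : even-prefix m ≡ isEven (inducedEdges G (xs ∷ʳ v))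
  whole = cong (isEven ∘ inducedEdges G)
               (take-all (suc m) (xs ∷ʳ v) (≤-reflexive (trans (length-∷ʳ xs v) (cong suc l))))

-- Without repetitions the whole sequence induces all of E(G); with one, both sides are false.
isEvenSequence-∷ʳ : ∀ {m} (G : Graph (suc m)) (w : Vec (Fin (suc m)) m) v →
                    isEvenSequence G (w V.∷ʳ v)
                    ≡ distinct (toList w ∷ʳ v) ∧ (evenPrefixesUpTo G m (toList w) ∧ isEven (numEdges G))
isEvenSequence-∷ʳ {m} G w v rewrite toList-∷ʳ v w | evenPrefixes-∷ʳ G (toList w) v (length-toList w)
  with distinct (toList w ∷ʳ v) in d
... | false = refl
... | true  = cong (λ e → evenPrefixesUpTo G m (toList w) ∧ isEven e)
                   (inducedEdges-ordering G (toList w ∷ʳ v) (d , length-w∷ʳv))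
  where
  length-w∷ʳv : length (toList w ∷ʳ v) ≡ suc m
  length-w∷ʳv = trans (length-∷ʳ (toList w) v) (cong suc (length-toList w))

evenPrefixesUpTo-map-punchIn : ∀ {m} (G : Graph (suc m)) v k xs →
                               evenPrefixesUpTo G k (map (punchIn v) xs) ≡ evenPrefixesUpTo (G -v v) k xs
evenPrefixesUpTo-map-punchIn G v k xs = cong and (map-cong prefix (upTo k))
  where
  prefix : ∀ i → isEven (inducedEdges G (take (suc i) (map (punchIn v) xs)))
               ≡ isEven (inducedEdges (G -v v) (take (suc i) xs))
  prefix i = cong isEven (trans (cong (inducedEdges G) (take-map (suc i) xs))
                                (inducedEdges-map-punchIn G v (take (suc i) xs)))

isEvenSequence-punchIn-∷ʳ : ∀ {m} (G : Graph (suc m)) → isEven (numEdges G) ≡ true → ∀ v (w : Vec (Fin m) m) →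
                            isEvenSequence G (V.map (punchIn v) w V.∷ʳ v) ≡ isEvenSequence (G -v v) w
isEvenSequence-punchIn-∷ʳ {m} G even v w = begin
  isEvenSequence G (V.map (punchIn v) w V.∷ʳ v)
    ≡⟨ isEvenSequence-∷ʳ G (V.map (punchIn v) w) v ⟩
  distinct (toList (V.map (punchIn v) w) ∷ʳ v)
    ∧ (evenPrefixesUpTo G m (toList (V.map (punchIn v) w)) ∧ isEven (numEdges G))
    ≡⟨ cong (λ xs → distinct (xs ∷ʳ v) ∧ (evenPrefixesUpTo G m xs ∧ isEven (numEdges G))) (toList-map (punchIn v) w) ⟩
  distinct (map (punchIn v) us ∷ʳ v) ∧ (evenPrefixesUpTo G m (map (punchIn v) us) ∧ isEven (numEdges G))
    ≡⟨ cong₂ _∧_ (distinct-map-∷ʳ (punchIn-injective v _ _) (punchInᵢ≢i v) us)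
                 (cong₂ _∧_ (evenPrefixesUpTo-map-punchIn G v m us) even) ⟩
  distinct us ∧ (evenPrefixes (G -v v) us ∧ true)
    ≡⟨ cong (distinct us ∧_) (∧-identityʳ _) ⟩
  isEvenSequence (G -v v) w ∎
  where
  us = toList w

η-∑ : ∀ {n} (G : Graph n) → η G ≡ ∑[ π ∈ allVecs n n ] 𝟙 (isEvenSequence G π)
η-∑ {n} G = length-filter-T? (isEvenSequence G) (allVecs n n)

η-∑-last : ∀ {m} (G : Graph (suc m)) →
           η G ≡ ∑[ v < suc m ] ∑[ w ∈ allVecs (suc m) m ] 𝟙 (isEvenSequence G (w V.∷ʳ v))
η-∑-last {m} G = trans (η-∑ G) (∑-allVecs-∷ʳ (suc m) m (𝟙 ∘ isEvenSequence G))

η-odd : ∀ {n} (G : Graph n) → isEven (numEdges G) ≡ false → η G ≡ 0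
η-odd {zero}  G ()
η-odd {suc m} G odd = begin
  η G                                                                          ≡⟨ η-∑-last G ⟩
  ∑[ v < suc m ] ∑[ w ∈ allVecs (suc m) m ] 𝟙 (isEvenSequence G (w V.∷ʳ v)) ≡⟨ sum-cong-≗ none-even ⟩
  ∑[ v < suc m ] 0                                                             ≡⟨ sum-replicate-zero (suc m) ⟩
  0                                                                            ∎
  where
  odd-ending : ∀ v w → isEvenSequence G (w V.∷ʳ v) ≡ false
  odd-ending v w rewrite isEvenSequence-∷ʳ G w v | odd
    = trans (cong (distinct (toList w ∷ʳ v) ∧_) (∧-zeroʳ (evenPrefixesUpTo G m (toList w))))
            (∧-zeroʳ (distinct (toList w ∷ʳ v)))
  none-even : ∀ v → ∑[ w ∈ allVecs (suc m) m ] 𝟙 (isEvenSequence G (w V.∷ʳ v)) ≡ 0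
  none-even v = ∑-zero (λ w → cong 𝟙 (odd-ending v w)) (allVecs (suc m) m)

η-ending-in : ∀ {m} (G : Graph (suc m)) → isEven (numEdges G) ≡ true → ∀ v →
              ∑[ w ∈ allVecs (suc m) m ] 𝟙 (isEvenSequence G (w V.∷ʳ v)) ≡ η (G -v v)
η-ending-in {m} G even v = begin
  ∑[ w ∈ allVecs (suc m) m ] 𝟙 (isEvenSequence G (w V.∷ʳ v))
    ≡⟨ ∑-allVecs-punchIn m m v _ (λ w v∈w → cong 𝟙 (repeats-v w v∈w)) ⟩
  ∑[ w ∈ allVecs m m ] 𝟙 (isEvenSequence G (V.map (punchIn v) w V.∷ʳ v))
    ≡⟨ ∑-cong (λ w → cong 𝟙 (isEvenSequence-punchIn-∷ʳ G even v w)) (allVecs m m) ⟩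
  ∑[ w ∈ allVecs m m ] 𝟙 (isEvenSequence (G -v v) w)
    ≡⟨ η-∑ (G -v v) ⟨
  η (G -v v) ∎
  where
  repeats-v : ∀ w → v ∈ w → isEvenSequence G (w V.∷ʳ v) ≡ false
  repeats-v w v∈w = trans (isEvenSequence-∷ʳ G w v) (cong (_∧ _) (distinct-∷ʳ-∈ (∈-toList⁺ v∈w)))

lemma3p5 : (∀ (n : ℕ) (G : Graph n) → isEven (numEdges G) ≡ false → η G ≡ 0)
           × (∀ (m : ℕ) (G : Graph (suc m)) → isEven (numEdges G) ≡ true →
                η G ≡ sum (map (λ v → η (G -v v)) (allFin (suc m))))
lemma3p5 = (λ n → η-odd) , λ m G even → begin
  η G                                                                          ≡⟨ η-∑-last G ⟩
  ∑[ v < suc m ] ∑[ w ∈ allVecs (suc m) m ] 𝟙 (isEvenSequence G (w V.∷ʳ v)) ≡⟨ sum-cong-≗ (η-ending-in G even) ⟩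
  ∑[ v < suc m ] η (G -v v)                                                    ≡⟨ ∑-tabulate (suc m) id (λ v → η (G -v v)) ⟨
  ∑[ v ∈ allFin (suc m) ] η (G -v v)                                           ∎
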